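{- Lexicographic sum is an ideally effective constructor, for the following representations: an element $\langle i,x\rangle$ of $X_1\oplus X_2$ is represented by $i$ together with the representation of $x$ in $X_i$; an ideal is represented by a pair $\langle i,J\rangle$ with $J\in\mathrm{Idl}(X_i)$ (given by its representation in $X_i$), where $\langle 1,J\rangle$ denotes $\{1\}\times J$ and $\langle 2,J\rangle$ denotes $\{1\}\times X_1\cup\{2\}\times J$.
   Context: A quasi-ordering (QO) $(X,\le)$ is a set with a reflexive transitive relation; it is a well-quasi-ordering (WQO) if every infinite sequence $(x_k)_k$ has $i<j$ with $x_i\le x_j$. For $S\subseteq X$, $\uparrow S=\{x\mid \exists y\in S: y\le x\}$ and $\downarrow S=\{x\mid\exists y\in S: x\le y\}$; $S$ is upwards-closed if $S=\uparrow S$ and downwards-closed if $S=\downarrow S$. An ideal is a non-empty, downwards-closed, directed subset; $\mathrm{Idl}(X)$ is the set of ideals. In a WQO the filters are the sets $\uparrow x$, $x\in X$. In a WQO every upwards-closed set is a finite union of filters and every downwards-closed set is a finite union of ideals; upwards-closed (resp. downwards-closed) sets are represented as finite lists of filters (resp. ideals), a filter $\uparrow x$ being represented by $x$. A WQO equipped with data structures (recursive sets of representations) for $X$ and $\mathrm{Idl}(X)$ is ideally effective if: (OD) $\le$ is decidable on $X$; (ID) inclusion is decidable on $\mathrm{Idl}(X)$; (PI) $x\mapsto\downarrow x$ is computable; (CF) the complement $X\setminus\uparrow x$ of a filter is computable as a finite union of ideals; (IF) the intersection of two filters is computable as a finite union of filters; (CI) the complement of an ideal is computable as a finite union of filters;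 (II) the intersection of two ideals is computable as a finite union of ideals. A presentation of an ideally effective WQO consists of the data structures for $X$ and $\mathrm{Idl}(X)$, algorithms for these seven operations, a decomposition of $X$ as a finite union of ideals, and a decomposition of $X$ as a finite union of filters. An order-theoretic constructor $C$ mapping QOs $(X_1,\le_1),\dots,(X_n,\le_n)$ to a QO $C[(X_1,\le_1),\dots,(X_n,\le_n)]$, and mapping WQOs to WQOs, is ideally effective if (1) $C[\dots]$ is ideally effective whenever each $(X_i,\le_i)$ is, and (2) a presentation of $C[\dots]$ is uniformly computable from presentations of the $(X_i,\le_i)$. The lexicographic sum of QOs $(X_1,\le_1),(X_2,\le_2)$ is $X_1\oplus X_2=\{1\}\times X_1\cup\{2\}\times X_2$ ordered by $\langle i,x\rangle\le_\oplus\langle j,y\rangle$ iff $i<j$, or $i=j$ and $x\le_i y$. Its ideals are exactly the sets $\{1\}\times J_1$ with $J_1\in\mathrm{Idl}(X_1)$ and $\{1\}\times X_1\cup\{2\}\times J_2$ with $J_2\in\mathrm{Idl}(X_2)$. -}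

module Defs where

open import Level using (Level; _⊔_; Lift; lift) renaming (suc to lsuc)
open import Data.Nat using (ℕ; _<_)
open import Data.Product using (Σ; ∃; _×_; _,_)
open import Data.Sum using (_⊎_; inj₁; inj₂)
open import Data.List using (List)
open import Data.List.Relation.Unary.Any using (Any)
open import Data.Empty using (⊥)
open import Data.Unit using (⊤)
open import Relation.Binary using (Rel)
open import Relation.Unary using (Pred; _⊆_; _≐_)
open import Relation.Nullary using (Dec; ¬_)
open import Function.Bundles using (_⇔_)

record IsQO {c ℓ : Level} (X : Set c) (_≤_ : Rel X ℓ) : Set (c ⊔ ℓ) where
  field
    reflexive  : ∀ x → x ≤ x
    transitive : ∀ {x y z} → x ≤ y → y ≤ z → x ≤ z

record IsWQO {c ℓ : Level} (X : Set c) (_≤_ : Rel X ℓ) : Set (c ⊔ ℓ) where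
  field
    isQO : IsQO X _≤_
    good : (f : ℕ → X) → Σ ℕ λ i → Σ ℕ λ j → i < j × f i ≤ f j

record IsIdeal {c ℓ : Level} (X : Set c) (_≤_ : Rel X ℓ) (D : Pred X ℓ) : Set (c ⊔ ℓ) where
  field
    nonEmpty   : ∃ λ x → D x
    downClosed : ∀ {x y} → x ≤ y → D y → D x
    directed   : ∀ {x y} → D x → D y → ∃ λ z → D z × x ≤ z × y ≤ z

InFilters : {c ℓ : Level} {X : Set c} (_≤_ : Rel X ℓ) → List X → Pred X (c ⊔ ℓ)
InFilters _≤_ xs z = Any (λ x → x ≤ z) xs

InIdeals : {c ℓ : Level} {X : Set c} {I : Set c} → (I → Pred X ℓ) → List I → Pred X (c ⊔ ℓ)
InIdeals ⟦_⟧ Js z = Any (λ J → ⟦ J ⟧ z) Js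

-- A presentation of an ideally effective WQO.  Elements are represented
-- by the elements of the type X itself; ideals are represented by the
-- type I, with interpretation ⟦_⟧ : I → Pred X ℓ.
record Presentation {c ℓ : Level} (X : Set c) (_≤_ : Rel X ℓ)
                    (I : Set c) (⟦_⟧ : I → Pred X ℓ) : Set (lsuc (c ⊔ ℓ)) where
  field
    isWQO      : IsWQO X _≤_
    repIdeal   : ∀ r → IsIdeal X _≤_ ⟦ r ⟧
    repAll     : ∀ (D : Pred X ℓ) → IsIdeal X _≤_ D → ¬ ¬ (∃ λ r → ⟦ r ⟧ ≐ D)
    decLeq     : ∀ x y → Dec (x ≤ y)
    decIncl    : ∀ J K → Dec (⟦ J ⟧ ⊆ ⟦ K ⟧)
    principal  : X → I
    principal-ok : ∀ x z → ⟦ principal x ⟧ z ⇔ (z ≤ x)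
    compFilter : X → List I
    compFilter-ok : ∀ x z → (¬ (x ≤ z)) ⇔ InIdeals ⟦_⟧ (compFilter x) z
    interFilter : X → X → List X
    interFilter-ok : ∀ x y z → (x ≤ z × y ≤ z) ⇔ InFilters _≤_ (interFilter x y) z
    compIdeal  : I → List X
    compIdeal-ok : ∀ J z → (¬ ⟦ J ⟧ z) ⇔ InFilters _≤_ (compIdeal J) z
    interIdeal : I → I → List I
    interIdeal-ok : ∀ J K z → (⟦ J ⟧ z × ⟦ K ⟧ z) ⇔ InIdeals ⟦_⟧ (interIdeal J K) z
    idealDecomp : List I
    idealDecomp-ok : ∀ z → InIdeals ⟦_⟧ idealDecomp z
    filterDecomp : List X
    filterDecomp-ok : ∀ z → InFilters _≤_ filterDecomp z

-- Lexicographic sum X₁ ⊕ X₂; ⟨1,x⟩ = inj₁ x, ⟨2,y⟩ = inj₂ y.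
module _ {c ℓ : Level} {X₁ X₂ : Set c} (_≤₁_ : Rel X₁ ℓ) (_≤₂_ : Rel X₂ ℓ) where

  LexSum : Rel (X₁ ⊎ X₂) ℓ
  LexSum (inj₁ x) (inj₁ x') = x ≤₁ x'
  LexSum (inj₁ x) (inj₂ y)  = Lift ℓ ⊤
  LexSum (inj₂ y) (inj₁ x)  = Lift ℓ ⊥
  LexSum (inj₂ y) (inj₂ y') = y ≤₂ y'

module _ {c ℓ : Level} {X₁ X₂ I₁ I₂ : Set c}
         (⟦_⟧₁ : I₁ → Pred X₁ ℓ) (⟦_⟧₂ : I₂ → Pred X₂ ℓ) where

  LexIdeal : I₁ ⊎ I₂ → Pred (X₁ ⊎ X₂) ℓ
  LexIdeal (inj₁ J) (inj₁ x) = ⟦ J ⟧₁ x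
  LexIdeal (inj₁ J) (inj₂ y) = Lift ℓ ⊥
  LexIdeal (inj₂ J) (inj₁ x) = Lift ℓ ⊤
  LexIdeal (inj₂ J) (inj₂ y) = ⟦ J ⟧₂ y

-- Everything is read off the shape of X₁ ⊕ X₂: the left summand lies entirely
-- below the right one.  Hence the ideals are the sets ⟨1,J⟩ = {1}×J and
-- ⟨2,J⟩ = {1}×X₁ ∪ {2}×J, every ⟨1,J⟩ is contained in every ⟨2,K⟩, and every
-- filter ↑⟨2,y⟩ is contained in every filter ↑⟨1,x⟩.
module Submission where

open import Defs
open import Level using (Level; lift; lower; _⊔_) renaming (suc to lsuc)
open import Data.Sum using (_⊎_; inj₁; inj₂; [_,_]′)
open import Data.Product using (∃; _×_; _,_; proj₁; proj₂)
open import Data.Nat using (ℕ; _<_; _+_)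
open import Data.Nat.Properties using (m<m+n; +-monoʳ-<; m<n⇒0<n)
open import Data.List using (List; []; _∷_; map; _++_)
open import Data.List.Relation.Unary.Any using (Any; here; there)
open import Data.List.Relation.Unary.Any.Properties using (map⁺; map⁻; ++⁺ˡ; ++⁺ʳ; ++⁻)
open import Data.Empty using (⊥-elim)
open import Data.Unit using (tt)
open import Relation.Binary using (Rel)
open import Relation.Binary.PropositionalEquality using (_≡_; refl; sym; subst)
open import Relation.Unary using (Pred; _⊆_; _≐_)
open import Relation.Nullary using (Dec; yes; no; ¬_)
open import Relation.Nullary.Decidable using (map′)
open import Function.Base using (_∘_; id)
open import Function.Bundles using (_⇔_; mk⇔; Equivalence)
open import Function.Properties.Equivalence using () renaming (trans to ⇔-trans; sym to ⇔-sym)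

private
  variable
    a p : Level
    A B C : Set a

both : A → B → A ⇔ B
both x y = mk⇔ (λ _ → y) (λ _ → x)

neither : ¬ A → ¬ B → A ⇔ B
neither ¬x ¬y = mk⇔ (⊥-elim ∘ ¬x) (⊥-elim ∘ ¬y)

into-map : {P : Pred B p} {f : A → B} {xs : List A}
         → C ⇔ Any (P ∘ f) xs → C ⇔ Any P (map f xs)
into-map C⇔ = mk⇔ (map⁺ ∘ Equivalence.to C⇔) (Equivalence.from C⇔ ∘ map⁻)

none : {P : Pred A p} {xs : List A} → (∀ x → ¬ P x) → ¬ Any P xs
none ¬P (here px)   = ¬P _ px
none ¬P (there pxs) = none ¬P pxs

++-dropʳ : {P : Pred A p} {xs ys : List A} → ¬ Any P ys → Any P (xs ++ ys) ⇔ Any P xs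
++-dropʳ {xs = xs} ¬ys = mk⇔ (λ mem → [ id , ⊥-elim ∘ ¬ys ]′ (++⁻ xs mem)) ++⁺ˡ

++-dropˡ : {P : Pred A p} {xs ys : List A} → ¬ Any P xs → Any P (xs ++ ys) ⇔ Any P ys
++-dropˡ {xs = xs} ¬xs = mk⇔ (λ mem → [ ⊥-elim ∘ ¬xs , id ]′ (++⁻ xs mem)) (++⁺ʳ xs)

any-singleton : {P : Pred A p} {x : A} → Any P (x ∷ []) ⇔ P x
any-singleton = mk⇔ (λ { (here px) → px ; (there ()) }) here

∩-of-nestedˡ : {P Q : Pred A p} → P ⊆ Q → ∀ z → (P z × Q z) ⇔ P z
∩-of-nestedˡ P⊆Q z = mk⇔ proj₁ (λ pz → pz , P⊆Q {z} pz)

∩-of-nestedʳ : {P Q : Pred A p} → Q ⊆ P → ∀ z → (P z × Q z) ⇔ Q z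
∩-of-nestedʳ Q⊆P z = mk⇔ proj₂ (λ qz → Q⊆P {z} qz , qz)

Complete : {c ℓ : Level} {Y R : Set c} → Rel Y ℓ → (R → Pred Y ℓ) → Set (c ⊔ lsuc ℓ)
Complete {ℓ = ℓ} {Y = Y} _≼_ ⟦_⟧ = ∀ (D : Pred Y ℓ) → IsIdeal Y _≼_ D → ¬ ¬ (∃ λ r → ⟦ r ⟧ ≐ D)

module LexOrder {c ℓ : Level} {X₁ X₂ : Set c} (_≤₁_ : Rel X₁ ℓ) (_≤₂_ : Rel X₂ ℓ) where

  X : Set c
  X = X₁ ⊎ X₂

  _≤_ : Rel X ℓ
  _≤_ = LexSum _≤₁_ _≤₂_

  lex-isQO : IsQO X₁ _≤₁_ → IsQO X₂ _≤₂_ → IsQO X _≤_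
  lex-isQO qo₁ qo₂ = record { reflexive = reflexive ; transitive = λ {x} {y} {z} → transitive {x} {y} {z} }
    where
      reflexive : ∀ x → x ≤ x
      reflexive (inj₁ x) = IsQO.reflexive qo₁ x
      reflexive (inj₂ y) = IsQO.reflexive qo₂ y

      transitive : ∀ {x y z} → x ≤ y → y ≤ z → x ≤ z
      transitive {inj₁ _} {inj₁ _} {inj₁ _} x≤y y≤z = IsQO.transitive qo₁ x≤y y≤z
      transitive {inj₁ _} {_}      {inj₂ _} _   _   = lift tt
      transitive {inj₁ _} {inj₂ _} {inj₁ _} _   ()
      transitive {inj₂ _} {inj₁ _} {_}      ()  _
      transitive {inj₂ _} {inj₂ _} {inj₁ _} _   ()
      transitive {inj₂ _} {inj₂ _} {inj₂ _} x≤y y≤z = IsQO.transitive qo₂ x≤y y≤z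

  lex-dec : (∀ x y → Dec (x ≤₁ y)) → (∀ x y → Dec (x ≤₂ y)) → ∀ u v → Dec (u ≤ v)
  lex-dec dec₁ dec₂ (inj₁ x) (inj₁ y) = dec₁ x y
  lex-dec dec₁ dec₂ (inj₁ x) (inj₂ y) = yes (lift tt)
  lex-dec dec₁ dec₂ (inj₂ x) (inj₁ y) = no lower
  lex-dec dec₁ dec₂ (inj₂ x) (inj₂ y) = dec₂ x y

  right-filter⊆left-filter : ∀ x y {w} → inj₂ y ≤ w → inj₁ x ≤ w
  right-filter⊆left-filter x y {inj₁ _} ()
  right-filter⊆left-filter x y {inj₂ _} _ = lift tt

  right-filters-miss : ∀ xs z → ¬ InFilters _≤_ (map inj₂ xs) (inj₁ z)
  right-filters-miss xs z = none (λ _ → lower) ∘ map⁻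

  fill₁ : X₁ → X → X₁
  fill₁ a (inj₁ x) = x
  fill₁ a (inj₂ _) = a

  fill₁-reflects : ∀ a u v → fill₁ a u ≤₁ fill₁ a v → u ≤ v ⊎ inj₁ a ≤ v
  fill₁-reflects a (inj₁ x) (inj₁ y) x≤y = inj₁ x≤y
  fill₁-reflects a (inj₂ x) (inj₁ y) a≤y = inj₂ a≤y
  fill₁-reflects a u        (inj₂ y) _   = inj₂ (lift tt)

  fill₂ : X₂ → X → X₂
  fill₂ b (inj₁ _) = b
  fill₂ b (inj₂ y) = y

  fill₂-reflects : ∀ b u v → fill₂ b u ≤₂ fill₂ b v → u ≤ v ⊎ ∃ λ x → v ≡ inj₁ x
  fill₂-reflects b u        (inj₁ x) _   = inj₂ (x , refl)
  fill₂-reflects b (inj₁ x) (inj₂ y) _   = inj₁ (lift tt)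
  fill₂-reflects b (inj₂ x) (inj₂ y) x≤y = inj₁ x≤y

  Good : (ℕ → X) → Set ℓ
  Good f = ∃ λ i → ∃ λ j → i < j × f i ≤ f j

  module _ (wqo₁ : IsWQO X₁ _≤₁_) (wqo₂ : IsWQO X₂ _≤₂_) where

    -- A sequence visiting the left summand, at index k, is good: apply the
    -- WQO X₁ to its tail from k, collapsed onto a; a failing pair lies above f k.
    good-after-left : ∀ f k a → f k ≡ inj₁ a → Good f
    good-after-left f k a fk≡a with IsWQO.good wqo₁ (fill₁ a ∘ f ∘ (k +_))
    ... | i , j , i<j , le with fill₁-reflects a (f (k + i)) (f (k + j)) le
    ...   | inj₁ fi≤fj = k + i , k + j , +-monoʳ-< k i<j , fi≤fj
    ...   | inj₂ a≤fj  = k , k + j , m<m+n k (m<n⇒0<n i<j) , subst (_≤ f (k + j)) (sym fk≡a) a≤fj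

    -- Otherwise the sequence starts on the right: apply the WQO X₂ to it,
    -- collapsed onto f 0; a failing pair lands in the left summand at index j.
    lex-good : ∀ f → Good f
    lex-good f with f 0 in f0≡
    ... | inj₁ a = good-after-left f 0 a f0≡
    ... | inj₂ b with IsWQO.good wqo₂ (fill₂ b ∘ f)
    ...   | i , j , i<j , le with fill₂-reflects b (f i) (f j) le
    ...     | inj₁ fi≤fj       = i , j , i<j , fi≤fj
    ...     | inj₂ (a , fj≡a)  = good-after-left f j a fj≡a

    lex-isWQO : IsWQO X _≤_
    lex-isWQO = record { isQO = lex-isQO (IsWQO.isQO wqo₁) (IsWQO.isQO wqo₂) ; good = lex-good }

module LexIdeals {c ℓ : Level} {X₁ X₂ I₁ I₂ : Set c}
                 (_≤₁_ : Rel X₁ ℓ) (_≤₂_ : Rel X₂ ℓ)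
                 (⟦_⟧₁ : I₁ → Pred X₁ ℓ) (⟦_⟧₂ : I₂ → Pred X₂ ℓ) where

  open LexOrder _≤₁_ _≤₂_ using (X; _≤_)

  I : Set c
  I = I₁ ⊎ I₂

  ⟦_⟧ : I → Pred X ℓ
  ⟦_⟧ = LexIdeal ⟦_⟧₁ ⟦_⟧₂

  left-isIdeal : ∀ J → IsIdeal X₁ _≤₁_ ⟦ J ⟧₁ → IsIdeal X _≤_ ⟦ inj₁ J ⟧
  left-isIdeal J idl = record
    { nonEmpty   = inj₁ (proj₁ J.nonEmpty) , proj₂ J.nonEmpty
    ; downClosed = λ {x} {y} → downClosed {x} {y}
    ; directed   = λ {x} {y} → directed {x} {y}
    }
    where
      module J = IsIdeal idl
      downClosed : ∀ {x y} → x ≤ y → ⟦ inj₁ J ⟧ y → ⟦ inj₁ J ⟧ x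
      downClosed {inj₁ _} {inj₁ _} x≤y y∈J = J.downClosed x≤y y∈J
      downClosed {inj₂ _} {inj₁ _} ()  _
      downClosed {_}      {inj₂ _} _   ()
      directed : ∀ {x y} → ⟦ inj₁ J ⟧ x → ⟦ inj₁ J ⟧ y → ∃ λ z → ⟦ inj₁ J ⟧ z × x ≤ z × y ≤ z
      directed {inj₁ _} {inj₁ _} x∈J y∈J with J.directed x∈J y∈J
      ... | z , z∈J , x≤z , y≤z = inj₁ z , z∈J , x≤z , y≤z
      directed {inj₁ _} {inj₂ _} _ ()
      directed {inj₂ _} {_}      ()

  -- ⟨2,J⟩ = {1}×X₁ ∪ {2}×J is an ideal when J is; two left elements have any
  -- element of J as upper bound.
  right-isIdeal : IsQO X₂ _≤₂_ → ∀ J → IsIdeal X₂ _≤₂_ ⟦ J ⟧₂ → IsIdeal X _≤_ ⟦ inj₂ J ⟧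
  right-isIdeal qo₂ J idl = record
    { nonEmpty   = inj₂ (proj₁ J.nonEmpty) , proj₂ J.nonEmpty
    ; downClosed = λ {x} {y} → downClosed {x} {y}
    ; directed   = λ {x} {y} → directed {x} {y}
    }
    where
      module J = IsIdeal idl
      downClosed : ∀ {x y} → x ≤ y → ⟦ inj₂ J ⟧ y → ⟦ inj₂ J ⟧ x
      downClosed {inj₁ _} {_}      _   _   = lift tt
      downClosed {inj₂ _} {inj₁ _} ()  _
      downClosed {inj₂ _} {inj₂ _} x≤y y∈J = J.downClosed x≤y y∈J
      directed : ∀ {x y} → ⟦ inj₂ J ⟧ x → ⟦ inj₂ J ⟧ y → ∃ λ z → ⟦ inj₂ J ⟧ z × x ≤ z × y ≤ z
      directed {inj₁ _} {inj₁ _} _   _   = inj₂ (proj₁ J.nonEmpty) , proj₂ J.nonEmpty , lift tt , lift tt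
      directed {inj₁ _} {inj₂ y} _   y∈J = inj₂ y , y∈J , lift tt , IsQO.reflexive qo₂ y
      directed {inj₂ x} {inj₁ _} x∈J _   = inj₂ x , x∈J , IsQO.reflexive qo₂ x , lift tt
      directed {inj₂ _} {inj₂ _} x∈J y∈J with J.directed x∈J y∈J
      ... | z , z∈J , x≤z , y≤z = inj₂ z , z∈J , x≤z , y≤z

  -- The right slice of an ideal meeting {2}×X₂ is an ideal of X₂; the ideal
  -- then contains all of {1}×X₁, hence equals ⟨2,J⟩ for any J denoting the slice.
  right-slice-isIdeal : ∀ {D : Pred X ℓ} → IsIdeal X _≤_ D → ∀ {y} → D (inj₂ y) → IsIdeal X₂ _≤₂_ (D ∘ inj₂)
  right-slice-isIdeal {D} idl {y} Dy = record
    { nonEmpty = y , Dy ; downClosed = Idl.downClosed ; directed = directed }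
    where
      module Idl = IsIdeal idl
      directed : ∀ {u v} → D (inj₂ u) → D (inj₂ v) → ∃ λ w → D (inj₂ w) × u ≤₂ w × v ≤₂ w
      directed Du Dv with Idl.directed Du Dv
      ... | inj₁ _ , _  , ()  , _
      ... | inj₂ w , Dw , u≤w , v≤w = w , Dw , u≤w , v≤w

  right-slice-denotes : ∀ {D : Pred X ℓ} → IsIdeal X _≤_ D → ∀ {y} → D (inj₂ y)
                      → ∀ J → ⟦ J ⟧₂ ≐ D ∘ inj₂ → ⟦ inj₂ J ⟧ ≐ D
  right-slice-denotes {D} idl {y} Dy J (J⊆D , D⊆J) = J⊆D′ , D⊆J′
    where
      J⊆D′ : ⟦ inj₂ J ⟧ ⊆ D
      J⊆D′ {inj₁ x} _   = IsIdeal.downClosed idl {inj₁ x} {inj₂ y} (lift tt) Dy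
      J⊆D′ {inj₂ _} u∈J = J⊆D u∈J
      D⊆J′ : D ⊆ ⟦ inj₂ J ⟧
      D⊆J′ {inj₁ _} _  = lift tt
      D⊆J′ {inj₂ _} Du = D⊆J Du

  left-slice-isIdeal : ∀ {D : Pred X ℓ} → IsIdeal X _≤_ D → (∀ y → ¬ D (inj₂ y)) → IsIdeal X₁ _≤₁_ (D ∘ inj₁)
  left-slice-isIdeal {D} idl no-right = record
    { nonEmpty = nonEmpty ; downClosed = Idl.downClosed ; directed = directed }
    where
      module Idl = IsIdeal idl
      nonEmpty : ∃ λ x → D (inj₁ x)
      nonEmpty with Idl.nonEmpty
      ... | inj₁ x , Dx = x , Dx
      ... | inj₂ y , Dy = ⊥-elim (no-right y Dy)
      directed : ∀ {u v} → D (inj₁ u) → D (inj₁ v) → ∃ λ w → D (inj₁ w) × u ≤₁ w × v ≤₁ w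
      directed Du Dv with Idl.directed Du Dv
      ... | inj₁ w , Dw , u≤w , v≤w = w , Dw , u≤w , v≤w
      ... | inj₂ w , Dw , _ , _     = ⊥-elim (no-right w Dw)

  left-slice-denotes : ∀ {D : Pred X ℓ} → (∀ y → ¬ D (inj₂ y))
                     → ∀ J → ⟦ J ⟧₁ ≐ D ∘ inj₁ → ⟦ inj₁ J ⟧ ≐ D
  left-slice-denotes {D} no-right J (J⊆D , D⊆J) = J⊆D′ , D⊆J′
    where
      J⊆D′ : ⟦ inj₁ J ⟧ ⊆ D
      J⊆D′ {inj₁ _} u∈J = J⊆D u∈J
      J⊆D′ {inj₂ _} ()
      D⊆J′ : D ⊆ ⟦ inj₁ J ⟧
      D⊆J′ {inj₁ _} Du = D⊆J Du
      D⊆J′ {inj₂ u} Du = ⊥-elim (no-right u Du)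

  -- Every ideal D is represented: were some ⟨2,y⟩ in D, its right slice would
  -- represent it; so D misses {2}×X₂, and its left slice represents it.
  lex-complete : Complete _≤₁_ ⟦_⟧₁ → Complete _≤₂_ ⟦_⟧₂ → Complete _≤_ ⟦_⟧
  lex-complete complete₁ complete₂ D idl unrepresented =
    complete₁ (D ∘ inj₁) (left-slice-isIdeal idl no-right)
      λ { (J , J≐D) → unrepresented (inj₁ J , left-slice-denotes no-right J J≐D) }
    where
      no-right : ∀ y → ¬ D (inj₂ y)
      no-right y Dy = complete₂ (D ∘ inj₂) (right-slice-isIdeal idl Dy)
        λ { (J , J≐D) → unrepresented (inj₂ J , right-slice-denotes idl Dy J J≐D) }

  -- Inclusion of ideals: ⟨1,J⟩ ⊆ ⟨2,K⟩ always, ⟨2,J⟩ ⊄ ⟨1,K⟩ since J ≠ ∅, and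
  -- within one summand inclusion is that of the summand.
  left⊆right : ∀ J K → ⟦ inj₁ J ⟧ ⊆ ⟦ inj₂ K ⟧
  left⊆right J K {inj₁ _} _ = lift tt
  left⊆right J K {inj₂ _} ()

  lex-decIncl : (∀ J K → Dec (⟦ J ⟧₁ ⊆ ⟦ K ⟧₁)) → (∀ J K → Dec (⟦ J ⟧₂ ⊆ ⟦ K ⟧₂))
              → (∀ J → ∃ ⟦ J ⟧₂) → ∀ J K → Dec (⟦ J ⟧ ⊆ ⟦ K ⟧)
  lex-decIncl decIncl₁ decIncl₂ nonEmpty₂ (inj₁ J) (inj₁ K) =
    map′ (λ J⊆K → λ { {inj₁ x} x∈J → J⊆K {x} x∈J ; {inj₂ _} () }) (λ J⊆K {x} → J⊆K {inj₁ x}) (decIncl₁ J K)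
  lex-decIncl decIncl₁ decIncl₂ nonEmpty₂ (inj₁ J) (inj₂ K) = yes (λ {w} → left⊆right J K {w})
  lex-decIncl decIncl₁ decIncl₂ nonEmpty₂ (inj₂ J) (inj₁ K) =
    no λ J⊆K → lower (J⊆K {inj₂ (proj₁ (nonEmpty₂ J))} (proj₂ (nonEmpty₂ J)))
  lex-decIncl decIncl₁ decIncl₂ nonEmpty₂ (inj₂ J) (inj₂ K) =
    map′ (λ J⊆K → λ { {inj₁ _} _ → lift tt ; {inj₂ y} y∈J → J⊆K {y} y∈J }) (λ J⊆K {y} → J⊆K {inj₂ y}) (decIncl₂ J K)

  left-ideals-miss : ∀ Js z → ¬ InIdeals ⟦_⟧ (map inj₁ Js) (inj₂ z)
  left-ideals-miss Js z = none (λ _ → lower) ∘ map⁻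

module LexPresentation {c ℓ : Level}
    {X₁ : Set c} {_≤₁_ : Rel X₁ ℓ} {I₁ : Set c} {⟦_⟧₁ : I₁ → Pred X₁ ℓ}
    {X₂ : Set c} {_≤₂_ : Rel X₂ ℓ} {I₂ : Set c} {⟦_⟧₂ : I₂ → Pred X₂ ℓ}
    (P₁ : Presentation X₁ _≤₁_ I₁ ⟦_⟧₁)
    (P₂ : Presentation X₂ _≤₂_ I₂ ⟦_⟧₂) where

  private
    module P₁ = Presentation P₁
    module P₂ = Presentation P₂

  open LexOrder _≤₁_ _≤₂_
  open LexIdeals _≤₁_ _≤₂_ ⟦_⟧₁ ⟦_⟧₂

  leftIdeals : List I
  leftIdeals = map inj₁ P₁.idealDecomp

  leftIdeals-cover : ∀ z → InIdeals ⟦_⟧ leftIdeals (inj₁ z)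
  leftIdeals-cover z = map⁺ (P₁.idealDecomp-ok z)

  rightFilters : List X
  rightFilters = map inj₂ P₂.filterDecomp

  rightFilters-cover : ∀ z → InFilters _≤_ rightFilters (inj₂ z)
  rightFilters-cover z = map⁺ (P₂.filterDecomp-ok z)

  principal : X → I
  principal (inj₁ x) = inj₁ (P₁.principal x)
  principal (inj₂ y) = inj₂ (P₂.principal y)

  principal-ok : ∀ x z → ⟦ principal x ⟧ z ⇔ (z ≤ x)
  principal-ok (inj₁ x) (inj₁ z) = P₁.principal-ok x z
  principal-ok (inj₁ x) (inj₂ z) = neither lower lower
  principal-ok (inj₂ y) (inj₁ z) = both (lift tt) (lift tt)
  principal-ok (inj₂ y) (inj₂ z) = P₂.principal-ok y z

  -- (CF) X ∖ ↑⟨1,x⟩ = ⟨1, X₁∖↑x⟩ and X ∖ ↑⟨2,y⟩ = {1}×X₁ ∪ ⟨2, X₂∖↑y⟩.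
  compFilter : X → List I
  compFilter (inj₁ x) = map inj₁ (P₁.compFilter x)
  compFilter (inj₂ y) = leftIdeals ++ map inj₂ (P₂.compFilter y)

  compFilter-ok : ∀ x z → (¬ (x ≤ z)) ⇔ InIdeals ⟦_⟧ (compFilter x) z
  compFilter-ok (inj₁ x) (inj₁ z) = into-map (P₁.compFilter-ok x z)
  compFilter-ok (inj₁ x) (inj₂ z) = neither (λ x≰z → x≰z (lift tt)) (left-ideals-miss _ z)
  compFilter-ok (inj₂ y) (inj₁ z) = both lower (++⁺ˡ (leftIdeals-cover z))
  compFilter-ok (inj₂ y) (inj₂ z) =
    ⇔-trans (into-map (P₂.compFilter-ok y z)) (⇔-sym (++-dropˡ (left-ideals-miss _ z)))

  -- (IF) ↑⟨1,x⟩ ∩ ↑⟨1,y⟩ = ⟨1, ↑x∩↑y⟩ ∪ {2}×X₂; ↑⟨2,y⟩ ⊆ ↑⟨1,x⟩;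
  -- ↑⟨2,x⟩ ∩ ↑⟨2,y⟩ = ⟨2, ↑x∩↑y⟩.
  interFilter : X → X → List X
  interFilter (inj₁ x) (inj₁ y) = map inj₁ (P₁.interFilter x y) ++ rightFilters
  interFilter (inj₁ x) (inj₂ y) = inj₂ y ∷ []
  interFilter (inj₂ x) (inj₁ y) = inj₂ x ∷ []
  interFilter (inj₂ x) (inj₂ y) = map inj₂ (P₂.interFilter x y)

  interFilter-ok : ∀ x y z → (x ≤ z × y ≤ z) ⇔ InFilters _≤_ (interFilter x y) z
  interFilter-ok (inj₁ x) (inj₁ y) (inj₁ z) =
    ⇔-trans (into-map (P₁.interFilter-ok x y z)) (⇔-sym (++-dropʳ (right-filters-miss _ z)))
  interFilter-ok (inj₁ x) (inj₁ y) (inj₂ z) =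
    both (lift tt , lift tt) (++⁺ʳ (map inj₁ (P₁.interFilter x y)) (rightFilters-cover z))
  interFilter-ok (inj₁ x) (inj₂ y) z =
    ⇔-trans (∩-of-nestedʳ (λ {w} → right-filter⊆left-filter x y {w}) z) (⇔-sym any-singleton)
  interFilter-ok (inj₂ x) (inj₁ y) z =
    ⇔-trans (∩-of-nestedˡ (λ {w} → right-filter⊆left-filter y x {w}) z) (⇔-sym any-singleton)
  interFilter-ok (inj₂ x) (inj₂ y) (inj₁ z) = neither (lower ∘ proj₁) (right-filters-miss _ z)
  interFilter-ok (inj₂ x) (inj₂ y) (inj₂ z) = into-map (P₂.interFilter-ok x y z)

  -- (CI) X ∖ ⟨1,J⟩ = ⟨1, X₁∖J⟩ ∪ {2}×X₂ and X ∖ ⟨2,J⟩ = ⟨2, X₂∖J⟩.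
  compIdeal : I → List X
  compIdeal (inj₁ J) = map inj₁ (P₁.compIdeal J) ++ rightFilters
  compIdeal (inj₂ J) = map inj₂ (P₂.compIdeal J)

  compIdeal-ok : ∀ J z → (¬ ⟦ J ⟧ z) ⇔ InFilters _≤_ (compIdeal J) z
  compIdeal-ok (inj₁ J) (inj₁ z) =
    ⇔-trans (into-map (P₁.compIdeal-ok J z)) (⇔-sym (++-dropʳ (right-filters-miss _ z)))
  compIdeal-ok (inj₁ J) (inj₂ z) = both lower (++⁺ʳ (map inj₁ (P₁.compIdeal J)) (rightFilters-cover z))
  compIdeal-ok (inj₂ J) (inj₁ z) = neither (λ z∉J → z∉J (lift tt)) (right-filters-miss _ z)
  compIdeal-ok (inj₂ J) (inj₂ z) = into-map (P₂.compIdeal-ok J z)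

  -- (II) ⟨1,J⟩ ∩ ⟨1,K⟩ = ⟨1, J∩K⟩; ⟨1,J⟩ ⊆ ⟨2,K⟩;
  -- ⟨2,J⟩ ∩ ⟨2,K⟩ = ⟨2, J∩K⟩ ∪ {1}×X₁.
  interIdeal : I → I → List I
  interIdeal (inj₁ J) (inj₁ K) = map inj₁ (P₁.interIdeal J K)
  interIdeal (inj₁ J) (inj₂ K) = inj₁ J ∷ []
  interIdeal (inj₂ J) (inj₁ K) = inj₁ K ∷ []
  interIdeal (inj₂ J) (inj₂ K) = map inj₂ (P₂.interIdeal J K) ++ leftIdeals

  interIdeal-ok : ∀ J K z → (⟦ J ⟧ z × ⟦ K ⟧ z) ⇔ InIdeals ⟦_⟧ (interIdeal J K) z
  interIdeal-ok (inj₁ J) (inj₁ K) (inj₁ z) = into-map (P₁.interIdeal-ok J K z)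
  interIdeal-ok (inj₁ J) (inj₁ K) (inj₂ z) = neither (lower ∘ proj₁) (left-ideals-miss _ z)
  interIdeal-ok (inj₁ J) (inj₂ K) z = ⇔-trans (∩-of-nestedˡ (λ {w} → left⊆right J K {w}) z) (⇔-sym any-singleton)
  interIdeal-ok (inj₂ J) (inj₁ K) z = ⇔-trans (∩-of-nestedʳ (λ {w} → left⊆right K J {w}) z) (⇔-sym any-singleton)
  interIdeal-ok (inj₂ J) (inj₂ K) (inj₁ z) =
    both (lift tt , lift tt) (++⁺ʳ (map inj₂ (P₂.interIdeal J K)) (leftIdeals-cover z))
  interIdeal-ok (inj₂ J) (inj₂ K) (inj₂ z) =
    ⇔-trans (into-map (P₂.interIdeal-ok J K z)) (⇔-sym (++-dropʳ (left-ideals-miss _ z)))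

  idealDecomp : List I
  idealDecomp = map inj₂ P₂.idealDecomp ++ leftIdeals

  idealDecomp-ok : ∀ z → InIdeals ⟦_⟧ idealDecomp z
  idealDecomp-ok (inj₁ z) = ++⁺ʳ (map inj₂ P₂.idealDecomp) (leftIdeals-cover z)
  idealDecomp-ok (inj₂ z) = ++⁺ˡ (map⁺ (P₂.idealDecomp-ok z))

  filterDecomp : List X
  filterDecomp = map inj₁ P₁.filterDecomp ++ rightFilters

  filterDecomp-ok : ∀ z → InFilters _≤_ filterDecomp z
  filterDecomp-ok (inj₁ z) = ++⁺ˡ (map⁺ (P₁.filterDecomp-ok z))
  filterDecomp-ok (inj₂ z) = ++⁺ʳ (map inj₁ P₁.filterDecomp) (rightFilters-cover z)

mainTheorem2 : {c ℓ : Level}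
    → (X₁ : Set c) (_≤₁_ : Rel X₁ ℓ) (I₁ : Set c) (⟦_⟧₁ : I₁ → Pred X₁ ℓ)
    → (X₂ : Set c) (_≤₂_ : Rel X₂ ℓ) (I₂ : Set c) (⟦_⟧₂ : I₂ → Pred X₂ ℓ)
    → Presentation X₁ _≤₁_ I₁ ⟦_⟧₁
    → Presentation X₂ _≤₂_ I₂ ⟦_⟧₂
    → Presentation (X₁ ⊎ X₂) (LexSum _≤₁_ _≤₂_) (I₁ ⊎ I₂) (LexIdeal ⟦_⟧₁ ⟦_⟧₂)
mainTheorem2 X₁ _≤₁_ I₁ ⟦_⟧₁ X₂ _≤₂_ I₂ ⟦_⟧₂ P₁ P₂ = record
  { isWQO          = lex-isWQO P₁.isWQO P₂.isWQO
  ; repIdeal       = λ { (inj₁ J) → left-isIdeal J (P₁.repIdeal J)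
                       ; (inj₂ J) → right-isIdeal (IsWQO.isQO P₂.isWQO) J (P₂.repIdeal J) }
  ; repAll         = lex-complete P₁.repAll P₂.repAll
  ; decLeq         = lex-dec P₁.decLeq P₂.decLeq
  ; decIncl        = lex-decIncl P₁.decIncl P₂.decIncl (IsIdeal.nonEmpty ∘ P₂.repIdeal)
  ; principal      = principal      ; principal-ok    = principal-ok
  ; compFilter     = compFilter     ; compFilter-ok   = compFilter-ok
  ; interFilter    = interFilter    ; interFilter-ok  = interFilter-ok
  ; compIdeal      = compIdeal      ; compIdeal-ok    = compIdeal-ok
  ; interIdeal     = interIdeal     ; interIdeal-ok   = interIdeal-ok
  ; idealDecomp    = idealDecomp    ; idealDecomp-ok  = idealDecomp-ok
  ; filterDecomp   = filterDecomp   ; filterDecomp-ok = filterDecomp-ok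
  }
  where
    module P₁ = Presentation P₁
    module P₂ = Presentation P₂
    open LexOrder _≤₁_ _≤₂_
    open LexIdeals _≤₁_ _≤₂_ ⟦_⟧₁ ⟦_⟧₂
    open LexPresentation P₁ P₂
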